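{- Let $G$ be a graph of order $n$. Then (a) $\Gamma_d(G) \le \alpha(G)\left(1 + 2\ln \chi(G)\right)$, and (b) $\Gamma_d(G) \le \alpha(G)\left(1 + 2\ln(d_{\mathrm{av}}(G) + 1)\right)$.
   Context: $\alpha(G)$ is the independence number, $\chi(G)$ the chromatic number, and $d_{\mathrm{av}}(G)$ the average degree of $G$; $\ln$ is the natural logarithm. For a digraph $D$, a directed dominating set is a set $S \subseteq V(D)$ such that every vertex $u \notin S$ has a vertex $v \in S$ with arc $(v,u)$; $\gamma(D)$ is the minimum size of such a set. For a graph $G$, $\Gamma_d(G) = \max\{\gamma(D) : D \text{ an orientation of } G\}$. -}

module Defs where

open import Data.Nat using (ℕ; zero; suc; _+_; _*_; NonZero)
import Data.Nat as ℕ
open import Data.Integer using (+_)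
open import Data.Rational using (ℚ; _/_; 1ℚ)
import Data.Rational as ℚ
open import Data.Bool using (Bool; true; false)
open import Data.Fin using (Fin)
open import Data.Fin.Subset using (Subset; _∈_; _∉_; ∣_∣)
open import Data.Vec using (tabulate)
open import Data.List using (map; allFin)
open import Data.Nat.ListAction using (sum)
open import Data.Product using (Σ; ∃; _×_)
open import Data.Sum using (_⊎_)
open import Relation.Binary.PropositionalEquality using (_≡_; _≢_)

record Graph (n : ℕ) : Set where
  field
    adj    : Fin n → Fin n → Bool
    sym    : ∀ u v → adj u v ≡ adj v u
    irrefl : ∀ u → adj u u ≡ false
open Graph public

record Orientation {n : ℕ} (G : Graph n) : Set where
  field
    arc     : Fin n → Fin n → Bool
    onEdges : ∀ u v → arc u v ≡ true → adj G u v ≡ true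
    oriented : ∀ u v → adj G u v ≡ true →
               (arc u v ≡ true × arc v u ≡ false) ⊎ (arc v u ≡ true × arc u v ≡ false)
open Orientation public

IsDirDominating : ∀ {n} {G : Graph n} → Orientation G → Subset n → Set
IsDirDominating {n} D S = ∀ u → u ∉ S → Σ (Fin n) λ v → v ∈ S × arc D v u ≡ true

IsDirDomNumber : ∀ {n} {G : Graph n} → Orientation G → ℕ → Set
IsDirDomNumber {n} D g =
  (Σ (Subset n) λ S → IsDirDominating D S × ∣ S ∣ ≡ g) ×
  (∀ (S : Subset n) → IsDirDominating D S → g ℕ.≤ ∣ S ∣)

IsOrientedDomNumber : ∀ {n} → Graph n → ℕ → Set
IsOrientedDomNumber G m =
  (Σ (Orientation G) λ D → IsDirDomNumber D m) ×
  (∀ (D : Orientation G) (g : ℕ) → IsDirDomNumber D g → g ℕ.≤ m)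

IsIndependent : ∀ {n} → Graph n → Subset n → Set
IsIndependent G S = ∀ u v → u ∈ S → v ∈ S → adj G u v ≡ false

IsIndependenceNumber : ∀ {n} → Graph n → ℕ → Set
IsIndependenceNumber {n} G a =
  (Σ (Subset n) λ S → IsIndependent G S × ∣ S ∣ ≡ a) ×
  (∀ (S : Subset n) → IsIndependent G S → ∣ S ∣ ℕ.≤ a)

IsProperColouring : ∀ {n} (G : Graph n) {c : ℕ} → (Fin n → Fin c) → Set
IsProperColouring G col = ∀ u v → adj G u v ≡ true → col u ≢ col v

IsChromaticNumber : ∀ {n} → Graph n → ℕ → Set
IsChromaticNumber {n} G c =
  (Σ (Fin n → Fin c) λ col → IsProperColouring G col) ×
  (∀ (c' : ℕ) (col : Fin n → Fin c') → IsProperColouring G col → c ℕ.≤ c')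

degree : ∀ {n} → Graph n → Fin n → ℕ
degree G u = ∣ tabulate (adj G u) ∣

avgDegree : ∀ {n} .{{_ : NonZero n}} → Graph n → ℚ
avgDegree {n} G = + sum (map (degree G) (allFin n)) / n

_^ℚ_ : ℚ → ℕ → ℚ
x ^ℚ zero  = 1ℚ
x ^ℚ suc k = x ℚ.* (x ^ℚ k)

-- j-th term k^j / j! of the exponential series, and partial sum Σ_{j ≤ M} k^j / j!
expTerm : ℕ → ℕ → ℚ
expTerm k zero    = 1ℚ
expTerm k (suc j) = expTerm k j ℚ.* (+ k / suc j)

expPartial : ℕ → ℕ → ℚ
expPartial k zero    = 1ℚ
expPartial k (suc M) = expPartial k M ℚ.+ expTerm k (suc M)

-- e^k ≤ x  (e^k is the supremum of the increasing partial sums)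
ExpLE : ℕ → ℚ → Set
ExpLE k x = ∀ M → expPartial k M ℚ.≤ x

-- "m ≤ a (1 + 2 ln x)" for naturals m, a and a rational x ≥ 1.
-- Equivalent (for x ≥ 1, x real) to: if m ≥ a then e^(m - a) ≤ x^(2a).
LeLnBound : ℕ → ℕ → ℚ → Set
LeLnBound m a x = ∀ k → a + k ≡ m → ExpLE k (x ^ℚ (2 * a))

-- Fix an orientation D with γ(D) = Γ_d(G) and put a = α(G). Build a dominating set of D greedily:
-- while more than a vertices remain, take a vertex of maximum out-degree Δ⁺ in the remaining set U
-- and delete its closed out-neighbourhood; at the end take the (at most a) remaining vertices.
-- Turán's bound |U|² ≤ a (2 e(U) + |U|) together with e(U) ≤ |U| Δ⁺ shows that each step deletes
-- at least |U| / 2a vertices, so j steps force a (2a / (2a - 1)) ^ j ≤ n, while Γ ≤ a + j.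
-- Comparing e ^ k with the negative binomial series of (1 - 1/2a) ^ (- 2ak) termwise gives
-- e ^ k ≤ (2a / (2a - 1)) ^ (2ak), hence e ^ (Γ - a) ≤ (n / a) ^ (2a). Finally n ≤ a χ (colour
-- classes are independent) and n ≤ a (d_av + 1) (Turán's bound for the whole vertex set).
module Submission where

module Combinatorics where

  open import Defs renaming (sym to adj-sym)
  open import Data.Nat using (ℕ; zero; suc; _+_; _*_; _^_; _≤_; _<_; _⊔_; _≤?_; _≤′_; ≤′-refl; ≤′-step;
                              pred; z≤n; s≤s; >-nonZero)
  open import Data.Nat.Properties hiding (_≟_)
  open import Data.Nat.Tactic.RingSolver using (solve-∀)
  open import Algebra.Properties.CommutativeSemigroup *-commutativeSemigroup using (x∙yz≈y∙xz; xy∙z≈y∙xz)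
  import Data.Nat.ListAction as List using (sum)
  open import Data.Bool using (Bool; true; false; _∧_; _∨_; not; if_then_else_)
  open import Data.Bool.Properties using (∨-zeroʳ)
  open import Data.Fin using (Fin; zero; suc)
  open import Data.Fin.Properties using (_≟_)
  open import Data.Fin.Subset using (_∈_; ∣_∣)
  open import Data.Fin.Subset.Properties using (∣p∣≤n)
  open import Data.Vec using (tabulate)
  open import Data.Vec.Properties using (lookup∘tabulate; []=⇒lookup; lookup⇒[]=)
  import Data.List as List using (map; allFin; tabulate)
  open import Data.List.Properties using (map-tabulate)
  open import Data.Product using (_×_; _,_; ∃-syntax; ∃₂; proj₁; proj₂)
  open import Data.Sum using (_⊎_; inj₁; inj₂)
  open import Function using (_∘_; flip; id)
  open import Relation.Binary.Definitions using (Reflexive; Transitive; Total)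
  open import Relation.Nullary using (does; yes; no; contradiction)
  open import Relation.Nullary.Decidable using (dec-false)
  open import Relation.Binary.PropositionalEquality
  open import Algebra.Properties.Semiring.Sum +-*-semiring
    using (sum-syntax; sum-cong-≗; sum-replicate-zero; ∑-distrib-+; ∑-comm; *-distribˡ-sum; *-distribʳ-sum)
    renaming (sum to ∑)

  private variable n : ℕ

  𝟙 : Bool → ℕ
  𝟙 b = if b then 1 else 0

  ∑-mono-≤ : {f g : Fin n → ℕ} → (∀ i → f i ≤ g i) → ∑ f ≤ ∑ g
  ∑-mono-≤ {zero}  f≤g = z≤n
  ∑-mono-≤ {suc n} f≤g = +-mono-≤ (f≤g zero) (∑-mono-≤ (f≤g ∘ suc))

  ∑-const : ∀ n c → ∑[ i < n ] c ≡ n * c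
  ∑-const zero    c = refl
  ∑-const (suc n) c = cong (c +_) (∑-const n c)

  -- Vertex sets are Boolean predicates; the Vec-based Subset of Defs only appears at the interface.
  VSet : ℕ → Set
  VSet n = Fin n → Bool

  full : ∀ n → VSet n
  full n _ = true

  card : VSet n → ℕ
  card U = ∑[ v < _ ] 𝟙 (U v)

  infix 4 _⊆_
  infixl 6 _∖_

  _⊆_ : VSet n → VSet n → Set
  U ⊆ V = ∀ w → U w ≡ true → V w ≡ true

  _∖_ : VSet n → VSet n → VSet n
  (U ∖ S) w = U w ∧ not (S w)

  ⁅_⁆ : Fin n → VSet n
  ⁅ v ⁆ w = does (v ≟ w)

  insert : Fin n → VSet n → VSet n
  insert v S w = ⁅ v ⁆ w ∨ S w

  ⊆-trans : {I U V : VSet n} → I ⊆ U → U ⊆ V → I ⊆ V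
  ⊆-trans I⊆U U⊆V w = U⊆V w ∘ I⊆U w

  ∖-⊆ : (U S : VSet n) → U ∖ S ⊆ U
  ∖-⊆ U S w with U w
  ... | true  = λ _ → refl
  ... | false = λ ()

  ∖-∋ : (U S : VSet n) {w : Fin n} → U w ≡ true → S w ≡ false → (U ∖ S) w ≡ true
  ∖-∋ U S Uw Sw rewrite Uw | Sw = refl

  ⊆∖⇒∉ : {I : VSet n} (U S : VSet n) → I ⊆ U ∖ S → ∀ {w} → S w ≡ true → I w ≡ false
  ⊆∖⇒∉ {I = I} U S I⊆U∖S {w} Sw with I w in Iw
  ... | false = refl
  ... | true with U w | I⊆U∖S w Iw
  ...   | true  | U∖Sw = contradiction (trans (sym U∖Sw) (cong not Sw)) λ ()
  ...   | false | ()

  ⁅⁆-refl : (v : Fin n) → ⁅ v ⁆ v ≡ true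
  ⁅⁆-refl zero    = refl
  ⁅⁆-refl (suc v) = ⁅⁆-refl v

  ⁅⁆⇒≡ : {v w : Fin n} → ⁅ v ⁆ w ≡ true → v ≡ w
  ⁅⁆⇒≡ {v = v} {w} _ with v ≟ w
  ... | yes v≡w = v≡w

  ⁅⁆-⊆ : {v : Fin n} {U : VSet n} → U v ≡ true → ⁅ v ⁆ ⊆ U
  ⁅⁆-⊆ {v = v} Uv w vw with refl ← ⁅⁆⇒≡ {v = v} vw = Uv

  insert-∋ : (v : Fin n) (S : VSet n) → insert v S v ≡ true
  insert-∋ v S rewrite ⁅⁆-refl v = refl

  ⊆-insert : (v : Fin n) (S : VSet n) → S ⊆ insert v S
  ⊆-insert v S w Sw rewrite Sw = ∨-zeroʳ (⁅ v ⁆ w)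

  insert-⊆ : {v : Fin n} {I U : VSet n} → U v ≡ true → I ⊆ U → insert v I ⊆ U
  insert-⊆ {v = v} Uv I⊆U w with v ≟ w
  ... | yes refl = λ _ → Uv
  ... | no _     = I⊆U w

  card-full : ∀ n → card (full n) ≡ n
  card-full n = trans (∑-const n 1) (*-identityʳ n)

  card-∅ : (U : VSet n) → (∀ w → U w ≡ false) → card U ≡ 0
  card-∅ {n} U empty = trans (sum-cong-≗ (cong 𝟙 ∘ empty)) (sum-replicate-zero n)

  card-⁅⁆ : (v : Fin n) → card ⁅ v ⁆ ≡ 1
  card-⁅⁆ {suc n} zero    = cong suc (sum-replicate-zero n)
  card-⁅⁆ {suc n} (suc v) = card-⁅⁆ v

  card-insert-≤ : (v : Fin n) (S : VSet n) → card (insert v S) ≤ suc (card S)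
  card-insert-≤ {n} v S = begin
    card (insert v S)                  ≤⟨ ∑-mono-≤ (λ w → 𝟙-∨ (⁅ v ⁆ w) (S w)) ⟩
    ∑[ w < n ] (𝟙 (⁅ v ⁆ w) + 𝟙 (S w)) ≡⟨ ∑-distrib-+ (𝟙 ∘ ⁅ v ⁆) (𝟙 ∘ S) ⟩
    card ⁅ v ⁆ + card S                ≡⟨ cong (_+ card S) (card-⁅⁆ v) ⟩
    suc (card S)                       ∎
    where
    open ≤-Reasoning
    𝟙-∨ : ∀ x y → 𝟙 (x ∨ y) ≤ 𝟙 x + 𝟙 y
    𝟙-∨ true  y = s≤s z≤n
    𝟙-∨ false y = ≤-refl

  card-insert : (v : Fin n) (S : VSet n) → S v ≡ false → card (insert v S) ≡ suc (card S)
  card-insert v S v∉S = trans (sum-cong-≗ split) (trans (∑-distrib-+ (𝟙 ∘ ⁅ v ⁆) (𝟙 ∘ S)) (cong (_+ card S) (card-⁅⁆ v)))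
    where
    split : ∀ w → 𝟙 (insert v S w) ≡ 𝟙 (⁅ v ⁆ w) + 𝟙 (S w)
    split w with v ≟ w
    ... | yes refl rewrite v∉S = refl
    ... | no _ = refl

  module _ {A : Set} {_≼_ : A → A → Set}
           (≼-refl : Reflexive _≼_) (≼-trans : Transitive _≼_) (≼-total : Total _≼_) where

    extremal : (P : VSet n) (g : Fin n → A) →
               (∀ w → P w ≡ false) ⊎ ∃[ v ] P v ≡ true × (∀ w → P w ≡ true → g w ≼ g v)
    extremal {zero}  P g = inj₁ λ ()
    extremal {suc n} P g with extremal (P ∘ suc) (g ∘ suc) | P zero in P0
    ... | inj₁ none | false = inj₁ λ { zero → P0 ; (suc i) → none i }
    ... | inj₁ none | true  = inj₂ (zero , P0 , λ
            { zero _ → ≼-refl ; (suc i) Pi → contradiction (trans (sym Pi) (none i)) λ () })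
    ... | inj₂ (v , Pv , opt) | false = inj₂ (suc v , Pv , λ
            { zero P0′ → contradiction (trans (sym P0′) P0) λ () ; (suc i) → opt i })
    ... | inj₂ (v , Pv , opt) | true with ≼-total (g zero) (g (suc v))
    ... | inj₁ g0≼gv = inj₂ (suc v , Pv , λ { zero _ → g0≼gv ; (suc i) → opt i })
    ... | inj₂ gv≼g0 = inj₂ (zero , P0 , λ { zero _ → ≼-refl ; (suc i) Pi → ≼-trans (opt i Pi) gv≼g0 })

  argmin : (P : VSet n) (g : Fin n → ℕ) →
           (∀ w → P w ≡ false) ⊎ ∃[ v ] P v ≡ true × (∀ w → P w ≡ true → g v ≤ g w)
  argmin = extremal ≤-refl (flip ≤-trans) (flip ≤-total)

  argmax : (P : VSet n) (g : Fin n → ℕ) →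
           (∀ w → P w ≡ false) ⊎ ∃[ v ] P v ≡ true × (∀ w → P w ≡ true → g w ≤ g v)
  argmax = extremal ≤-refl ≤-trans ≤-total

  module _ (R : Fin n → Fin n → Bool) where

    deg : VSet n → Fin n → ℕ
    deg U v = ∑[ w < n ] (𝟙 (U w) * 𝟙 (R v w))

    degSum : VSet n → ℕ
    degSum U = ∑[ v < n ] (𝟙 (U v) * deg U v)

    closedNbhd : Fin n → VSet n
    closedNbhd v = insert v (R v)

  closedNbhd-∋ : (R : Fin n → Fin n → Bool) {v w : Fin n} → R v w ≡ true → closedNbhd R v w ≡ true
  closedNbhd-∋ R {v} {w} Rvw rewrite Rvw = ∨-zeroʳ (⁅ v ⁆ w)

  closedNbhd-∌ : (R : Fin n → Fin n → Bool) {v w : Fin n} → v ≢ w → R v w ≡ false → closedNbhd R v w ≡ false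
  closedNbhd-∌ R {v} {w} v≢w Rvw rewrite dec-false (v ≟ w) v≢w | Rvw = refl

  deg-mono : (R : Fin n → Fin n → Bool) {U V : VSet n} → U ⊆ V → ∀ v → deg R U v ≤ deg R V v
  deg-mono R U⊆V v = ∑-mono-≤ λ w → *-monoˡ-≤ (𝟙 (R v w)) (𝟙-mono (U⊆V w))
    where
    𝟙-mono : ∀ {x y} → (x ≡ true → y ≡ true) → 𝟙 x ≤ 𝟙 y
    𝟙-mono {false} _ = z≤n
    𝟙-mono {true} x⇒y rewrite x⇒y refl = ≤-refl

  module _ {R : Fin n → Fin n → Bool} (R-irrefl : ∀ v → R v v ≡ false)
           (U : VSet n) {v : Fin n} (Uv : U v ≡ true) where

    private
      removed : Fin n → ℕ
      removed w = 𝟙 (⁅ v ⁆ w) + 𝟙 (U w) * 𝟙 (R v w)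

      𝟙-split : ∀ w → 𝟙 (U w) ≡ 𝟙 ((U ∖ closedNbhd R v) w) + removed w
      𝟙-split w with v ≟ w
      ... | yes refl rewrite Uv | R-irrefl v = refl
      ... | no _ with U w | R v w
      ...   | true  | true  = refl
      ...   | true  | false = refl
      ...   | false | _     = refl

      ∑-removed : ∑[ w < n ] removed w ≡ suc (deg R U v)
      ∑-removed = trans (∑-distrib-+ (𝟙 ∘ ⁅ v ⁆) _) (cong (_+ deg R U v) (card-⁅⁆ v))

    card-∖closedNbhd : card U ≡ card (U ∖ closedNbhd R v) + suc (deg R U v)
    card-∖closedNbhd = trans (sum-cong-≗ 𝟙-split)
      (trans (∑-distrib-+ (𝟙 ∘ (U ∖ closedNbhd R v)) removed) (cong (card (U ∖ closedNbhd R v) +_) ∑-removed))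

    degSum-∖closedNbhd-min : (∀ w → U w ≡ true → deg R U v ≤ deg R U w) →
      degSum R (U ∖ closedNbhd R v) + suc (deg R U v) * deg R U v ≤ degSum R U
    degSum-∖closedNbhd-min v-min = begin
      degSum R U′ + suc δ * δ
        ≡⟨ cong (λ k → degSum R U′ + k * δ) ∑-removed ⟨
      degSum R U′ + ∑[ w < n ] removed w * δ
        ≡⟨ cong (degSum R U′ +_) (*-distribʳ-sum δ removed) ⟩
      degSum R U′ + ∑[ w < n ] (removed w * δ)
        ≡⟨ ∑-distrib-+ (λ w → 𝟙 (U′ w) * deg R U′ w) _ ⟨
      ∑[ w < n ] (𝟙 (U′ w) * deg R U′ w + removed w * δ)
        ≤⟨ ∑-mono-≤ (λ w → +-mono-≤ (*-monoʳ-≤ (𝟙 (U′ w)) (deg-mono R (∖-⊆ U _) w)) (removed-min w)) ⟩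
      ∑[ w < n ] (𝟙 (U′ w) * deg R U w + removed w * deg R U w)
        ≡⟨ sum-cong-≗ (λ w → trans (cong (_* deg R U w) (𝟙-split w)) (*-distribʳ-+ (deg R U w) (𝟙 (U′ w)) (removed w))) ⟨
      degSum R U ∎
      where
      open ≤-Reasoning
      U′ = U ∖ closedNbhd R v
      δ = deg R U v
      removed-min : ∀ w → removed w * δ ≤ removed w * deg R U w
      removed-min w with U w in Uw
      ... | true = *-monoʳ-≤ (𝟙 (⁅ v ⁆ w) + 1 * 𝟙 (R v w)) (v-min w Uw)
      ... | false with v ≟ w
      ...   | no _     = ≤-refl
      ...   | yes refl = contradiction (trans (sym Uv) Uw) λ ()

  private
    2*m*n≤m*m+n*n-ordered : ∀ {m n} → m ≤ n → 2 * (m * n) ≤ m * m + n * n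
    2*m*n≤m*m+n*n-ordered {m} m≤n with d , refl ← m≤n⇒∃[o]m+o≡n m≤n =
      subst₂ _≤_ (lhs m d) (rhs m d) (m≤m+n (2 * (m * m) + 2 * (m * d)) (d * d))
      where
      lhs : ∀ m d → 2 * (m * m) + 2 * (m * d) ≡ 2 * (m * (m + d))
      lhs = solve-∀
      rhs : ∀ m d → 2 * (m * m) + 2 * (m * d) + d * d ≡ m * m + (m + d) * (m + d)
      rhs = solve-∀

  2*m*n≤m*m+n*n : ∀ m n → 2 * (m * n) ≤ m * m + n * n
  2*m*n≤m*m+n*n m n with ≤-total m n
  ... | inj₁ m≤n = 2*m*n≤m*m+n*n-ordered m≤n
  ... | inj₂ n≤m = subst₂ _≤_ (cong (2 *_) (*-comm n m)) (+-comm (n * n) (m * m)) (2*m*n≤m*m+n*n-ordered n≤m)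

  -- Cauchy–Schwarz for the vectors (√b, 1) and (m / √b, s).
  square-+-≤ : ∀ b m X s → m * m ≤ b * X → (m + s) * (m + s) ≤ suc b * (X + s * s)
  square-+-≤ zero    zero    X s _      = ≤-trans (m≤n+m (s * s) X) (≤-reflexive (sym (*-identityˡ _)))
  square-+-≤ zero    (suc m) X s ()
  square-+-≤ (suc b′) m      X s m²≤bX = *-cancelˡ-≤ b (begin
    b * ((m + s) * (m + s))                               ≡⟨ expand b m s ⟩
    b * (m * m) + 2 * (m * (b * s)) + b * (s * s)         ≤⟨ +-monoˡ-≤ (b * (s * s))
                                                               (+-monoʳ-≤ (b * (m * m)) (2*m*n≤m*m+n*n m (b * s))) ⟩
    b * (m * m) + (m * m + b * s * (b * s)) + b * (s * s) ≡⟨ regroup b m s ⟩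
    suc b * (m * m) + b * (suc b * (s * s))               ≤⟨ +-monoˡ-≤ (b * (suc b * (s * s))) (*-monoʳ-≤ (suc b) m²≤bX) ⟩
    suc b * (b * X) + b * (suc b * (s * s))               ≡⟨ factor b X s ⟩
    b * (suc b * (X + s * s))                             ∎)
    where
    open ≤-Reasoning
    b = suc b′
    expand : ∀ b m s → b * ((m + s) * (m + s)) ≡ b * (m * m) + 2 * (m * (b * s)) + b * (s * s)
    expand = solve-∀
    regroup : ∀ b m s → b * (m * m) + (m * m + b * s * (b * s)) + b * (s * s) ≡ suc b * (m * m) + b * (suc b * (s * s))
    regroup = solve-∀
    factor : ∀ b X s → suc b * (b * X) + b * (suc b * (s * s)) ≡ b * (suc b * (X + s * s))
    factor = solve-∀

  module _ (G : Graph n) where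

    Independent : VSet n → Set
    Independent I = ∀ u w → I u ≡ true → I w ≡ true → adj G u w ≡ false

    ⁅⁆-independent : (v : Fin n) → Independent ⁅ v ⁆
    ⁅⁆-independent v u w vu vw with refl ← ⁅⁆⇒≡ {v = v} vu | refl ← ⁅⁆⇒≡ {v = v} vw = irrefl G v

    insert-independent : {v : Fin n} {I : VSet n} → Independent I →
      (∀ w → I w ≡ true → adj G v w ≡ false) → Independent (insert v I)
    insert-independent {v} indep nonadj u w Iu Iw with v ≟ u | v ≟ w
    ... | yes refl | yes refl = irrefl G v
    ... | yes refl | no _     = nonadj w Iw
    ... | no _     | yes refl = trans (adj-sym G u v) (nonadj u Iu)
    ... | no _     | no _     = indep u w Iu Iw

    ⊆∖closedNbhd⇒nonadjacent : ∀ {I} U v → I ⊆ U ∖ closedNbhd (adj G) v →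
      ∀ w → I w ≡ true → adj G v w ≡ false
    ⊆∖closedNbhd⇒nonadjacent U v I⊆ w Iw with adj G v w in vw
    ... | false = refl
    ... | true  = contradiction (trans (sym Iw) (⊆∖⇒∉ U (closedNbhd (adj G) v) I⊆ (closedNbhd-∋ (adj G) vw))) λ ()

    -- Induction on b, deleting the closed neighbourhood of a vertex of minimum degree.
    turán : ∀ b U → (∀ I → I ⊆ U → Independent I → card I ≤ b) →
            card U * card U ≤ b * (degSum (adj G) U + card U)
    turán b U α≤b with argmin U (deg (adj G) U)
    ... | inj₁ empty rewrite card-∅ U empty = z≤n
    turán zero U α≤b | inj₂ (v , Uv , _) =
      contradiction (subst (_≤ 0) (card-⁅⁆ v) (α≤b ⁅ v ⁆ (⁅⁆-⊆ Uv) (⁅⁆-independent v))) λ ()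
    turán (suc b) U α≤b | inj₂ (v , Uv , v-min) = begin
      card U * card U
        ≡⟨ cong (λ k → k * k) (card-∖closedNbhd (irrefl G) U Uv) ⟩
      (card U′ + suc δ) * (card U′ + suc δ)
        ≤⟨ square-+-≤ b (card U′) (degSum (adj G) U′ + card U′) (suc δ) (turán b U′ α[U′]≤b) ⟩
      suc b * (degSum (adj G) U′ + card U′ + suc δ * suc δ)
        ≡⟨ cong (suc b *_) (regroup (degSum (adj G) U′) (card U′) δ) ⟩
      suc b * ((degSum (adj G) U′ + suc δ * δ) + (card U′ + suc δ))
        ≤⟨ *-monoʳ-≤ (suc b) (+-mono-≤ (degSum-∖closedNbhd-min (irrefl G) U Uv v-min)
                                       (≤-reflexive (sym (card-∖closedNbhd (irrefl G) U Uv)))) ⟩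
      suc b * (degSum (adj G) U + card U) ∎
      where
      open ≤-Reasoning
      U′ = U ∖ closedNbhd (adj G) v
      δ = deg (adj G) U v
      α[U′]≤b : ∀ I → I ⊆ U′ → Independent I → card I ≤ b
      α[U′]≤b I I⊆U′ indep = ≤-pred (subst (_≤ suc b)
        (card-insert v I (⊆∖⇒∉ U (closedNbhd (adj G) v) I⊆U′ (insert-∋ v (adj G v))))
        (α≤b (insert v I) (insert-⊆ Uv (⊆-trans I⊆U′ (∖-⊆ U (closedNbhd (adj G) v))))
             (insert-independent indep (⊆∖closedNbhd⇒nonadjacent U v I⊆U′))))
      regroup : ∀ D m d → D + m + suc d * suc d ≡ (D + suc d * d) + (m + suc d)
      regroup = solve-∀

  module _ {G : Graph n} (D : Orientation G) where

    arc-irrefl : ∀ v → arc D v v ≡ false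
    arc-irrefl v with arc D v v in vv
    ... | false = refl
    ... | true  = contradiction (trans (sym (onEdges D v v vv)) (irrefl G v)) λ ()

    𝟙-adj : ∀ v w → 𝟙 (adj G v w) ≡ 𝟙 (arc D v w) + 𝟙 (arc D w v)
    𝟙-adj v w with adj G v w in vw
    ... | true with oriented D v w vw
    ...   | inj₁ (vw⃗ , wv⃗) rewrite vw⃗ | wv⃗ = refl
    ...   | inj₂ (wv⃗ , vw⃗) rewrite vw⃗ | wv⃗ = refl
    𝟙-adj v w | false with arc D v w in vw⃗ | arc D w v in wv⃗
    ... | false | false = refl
    ... | true  | _     = contradiction (trans (sym (onEdges D v w vw⃗)) vw) λ ()
    ... | false | true  = contradiction (trans (sym (trans (adj-sym G v w) (onEdges D w v wv⃗))) vw) λ ()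

    handshake : ∀ U → degSum (adj G) U ≡ 2 * degSum (arc D) U
    handshake U = begin
      ∑[ v < n ] (𝟙 (U v) * ∑[ w < n ] (𝟙 (U w) * 𝟙 (adj G v w)))
        ≡⟨ sum-cong-≗ (λ v → *-distribˡ-sum (𝟙 (U v)) (λ w → 𝟙 (U w) * 𝟙 (adj G v w))) ⟩
      ∑[ v < n ] ∑[ w < n ] (𝟙 (U v) * (𝟙 (U w) * 𝟙 (adj G v w)))
        ≡⟨ sum-cong-≗ (λ v → sum-cong-≗ (split v)) ⟩
      ∑[ v < n ] ∑[ w < n ] (f v w + f w v)
        ≡⟨ sum-cong-≗ (λ v → ∑-distrib-+ (f v) (flip f v)) ⟩
      ∑[ v < n ] (∑[ w < n ] f v w + ∑[ w < n ] f w v)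
        ≡⟨ ∑-distrib-+ (λ v → ∑[ w < n ] f v w) _ ⟩
      ∑[ v < n ] ∑[ w < n ] f v w + ∑[ v < n ] ∑[ w < n ] f w v
        ≡⟨ cong (∑[ v < n ] ∑[ w < n ] f v w +_) (∑-comm (flip f)) ⟩
      ∑[ v < n ] ∑[ w < n ] f v w + ∑[ v < n ] ∑[ w < n ] f v w
        ≡⟨ cong (∑[ v < n ] ∑[ w < n ] f v w +_) (+-identityʳ _) ⟨
      2 * ∑[ v < n ] ∑[ w < n ] f v w
        ≡⟨ cong (2 *_) (sum-cong-≗ (λ v → *-distribˡ-sum (𝟙 (U v)) (λ w → 𝟙 (U w) * 𝟙 (arc D v w)))) ⟨
      2 * degSum (arc D) U ∎
      where
      open ≡-Reasoning
      f : Fin n → Fin n → ℕ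
      f v w = 𝟙 (U v) * (𝟙 (U w) * 𝟙 (arc D v w))
      split : ∀ v w → 𝟙 (U v) * (𝟙 (U w) * 𝟙 (adj G v w)) ≡ f v w + f w v
      split v w = trans (cong (λ k → 𝟙 (U v) * (𝟙 (U w) * k)) (𝟙-adj v w))
                        (distribute (𝟙 (U v)) (𝟙 (U w)) (𝟙 (arc D v w)) (𝟙 (arc D w v)))
        where
        distribute : ∀ x y p q → x * (y * (p + q)) ≡ x * (y * p) + y * (x * q)
        distribute = solve-∀

  module Ratio (a′ : ℕ) where

    -- K = 2a - 1 is written pred N so that N reduces to suc K.
    a N K : ℕ
    a = suc a′
    N = 2 * a
    K = pred N

    N*m′≤K*m : ∀ {m m′ o} → m ≡ m′ + suc o → m ≤ a * (2 * o + 1) → N * m′ ≤ K * m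
    N*m′≤K*m {m} {m′} {o} refl m≤a[2o+1] = +-cancelʳ-≤ m (N * m′) (K * m) (begin
      N * m′ + m                ≤⟨ +-monoʳ-≤ (N * m′) m≤a[2o+1] ⟩
      N * m′ + a * (2 * o + 1)  ≤⟨ +-monoʳ-≤ (N * m′) (≤-trans (m≤m+n _ a) (≤-reflexive (grow a′ o))) ⟩
      N * m′ + N * suc o        ≡⟨ *-distribˡ-+ N m′ (suc o) ⟨
      N * m                     ≡⟨ +-comm m (K * m) ⟩
      K * m + m                 ∎)
      where
      open ≤-Reasoning
      grow : ∀ a′ o → suc a′ * (2 * o + 1) + suc a′ ≡ 2 * suc a′ * suc o
      grow = solve-∀

    N*a≤K*m : ∀ {m} → a < m → N * a ≤ K * m
    N*a≤K*m {m} a<m = begin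
      N * a          ≤⟨ m≤m+n (N * a) a′ ⟩
      N * a + a′     ≡⟨ expand a′ ⟩
      K * suc a      ≤⟨ *-monoʳ-≤ K a<m ⟩
      K * m          ∎
      where
      open ≤-Reasoning
      expand : ∀ a′ → 2 * suc a′ * suc a′ + a′ ≡ (a′ + (suc a′ + 0)) * suc (suc a′)
      expand = solve-∀

    geometric-step : ∀ {j m′ m} → a * N ^ j ≤ m′ * K ^ j → N * m′ ≤ K * m → a * N ^ suc j ≤ m * K ^ suc j
    geometric-step {j} {m′} {m} a[N/K]ʲ≤m′ N*m′≤K*m = begin
      a * (N * N ^ j)    ≡⟨ x∙yz≈y∙xz a N (N ^ j) ⟩
      N * (a * N ^ j)    ≤⟨ *-monoʳ-≤ N a[N/K]ʲ≤m′ ⟩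
      N * (m′ * K ^ j)   ≡⟨ *-assoc N m′ (K ^ j) ⟨
      N * m′ * K ^ j     ≤⟨ *-monoˡ-≤ (K ^ j) N*m′≤K*m ⟩
      K * m * K ^ j      ≡⟨ xy∙z≈y∙xz K m (K ^ j) ⟩
      m * (K * K ^ j)    ∎
      where open ≤-Reasoning

    geometric-pred : ∀ {j m} → a * N ^ suc j ≤ m * K ^ suc j → a * N ^ j ≤ m * K ^ j
    geometric-pred {j} {m} a[N/K]ʲ⁺¹≤m = *-cancelˡ-≤ N (begin
      N * (a * N ^ j)    ≡⟨ x∙yz≈y∙xz N a (N ^ j) ⟩
      a * (N * N ^ j)    ≤⟨ a[N/K]ʲ⁺¹≤m ⟩
      m * (K * K ^ j)    ≡⟨ x∙yz≈y∙xz m K (K ^ j) ⟩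
      K * (m * K ^ j)    ≤⟨ *-monoˡ-≤ (m * K ^ j) (n≤1+n K) ⟩
      N * (m * K ^ j)    ∎)
      where open ≤-Reasoning

    geometric-≤′ : ∀ {k j} m → k ≤′ j → a * N ^ j ≤ m * K ^ j → a * N ^ k ≤ m * K ^ k
    geometric-≤′ m ≤′-refl            = id
    geometric-≤′ m (≤′-step {j} k≤′j) = geometric-≤′ m k≤′j ∘ geometric-pred {j} {m}

  module GreedyDomination {G : Graph n} (D : Orientation G) (a′ : ℕ)
    (turán-bound : ∀ U → card U * card U ≤ suc a′ * (degSum (adj G) U + card U)) where
    open Ratio a′

    Dominates : VSet n → VSet n → Set
    Dominates U S = ∀ u → U u ≡ true → S u ≡ true ⊎ ∃[ v ] S v ≡ true × arc D v u ≡ true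

    insert-dominates : ∀ U S v → Dominates (U ∖ closedNbhd (arc D) v) S → Dominates U (insert v S)
    insert-dominates U S v dom u Uu with v ≟ u
    ... | yes refl = inj₁ refl
    ... | no v≢u with arc D v u in vu⃗
    ...   | true  = inj₂ (v , insert-∋ v S , vu⃗)
    ...   | false with dom u (∖-∋ U (closedNbhd (arc D) v) Uu (closedNbhd-∌ (arc D) v≢u vu⃗))
    ...     | inj₁ Su              = inj₁ Su
    ...     | inj₂ (w , Sw , wu⃗) = inj₂ (w , ⊆-insert v S w Sw , wu⃗)

    card≤a[2Δ⁺+1] : ∀ U {v} → 0 < card U → (∀ w → U w ≡ true → deg (arc D) U w ≤ deg (arc D) U v) →
                    card U ≤ a * (2 * deg (arc D) U v + 1)
    card≤a[2Δ⁺+1] U {v} 0<m v-max = *-cancelˡ-≤ m {{>-nonZero 0<m}} (begin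
      m * m                          ≤⟨ turán-bound U ⟩
      a * (degSum (adj G) U + m)     ≡⟨ cong (λ k → a * (k + m)) (handshake D U) ⟩
      a * (2 * degSum (arc D) U + m) ≤⟨ *-monoʳ-≤ a (+-monoˡ-≤ m (*-monoʳ-≤ 2 arcs≤m*Δ)) ⟩
      a * (2 * (m * Δ) + m)          ≡⟨ regroup a m Δ ⟩
      m * (a * (2 * Δ + 1))          ∎)
      where
      open ≤-Reasoning
      m = card U
      Δ = deg (arc D) U v
      arcs≤m*Δ : degSum (arc D) U ≤ m * Δ
      arcs≤m*Δ = ≤-trans (∑-mono-≤ bounded) (≤-reflexive (sym (*-distribʳ-sum Δ (𝟙 ∘ U))))
        where
        bounded : ∀ w → 𝟙 (U w) * deg (arc D) U w ≤ 𝟙 (U w) * Δ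
        bounded w with U w in Uw
        ... | true  = *-monoʳ-≤ 1 (v-max w Uw)
        ... | false = z≤n
      regroup : ∀ a m Δ → a * (2 * (m * Δ) + m) ≡ m * (a * (2 * Δ + 1))
      regroup = solve-∀

    SmallDominator : VSet n → Set
    SmallDominator U = ∃₂ λ S j → Dominates U S × card S ≤ a + j × a * N ^ j ≤ (a ⊔ card U) * K ^ j

    small-dominator : ∀ U → card U ≤ a → SmallDominator U
    small-dominator U m≤a =
      U , 0 , (λ _ → inj₁) , ≤-trans m≤a (≤-reflexive (sym (+-identityʳ a))) , *-monoˡ-≤ 1 (m≤m⊔n a (card U))

    dominator-step : ∀ U {v} → U v ≡ true → (∀ w → U w ≡ true → deg (arc D) U w ≤ deg (arc D) U v) →
                     a < card U → SmallDominator (U ∖ closedNbhd (arc D) v) → SmallDominator U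
    dominator-step U {v} Uv v-max a<m (S′ , j , dom′ , |S′|≤a+j , a[N/K]ʲ≤m′) =
      insert v S′ , suc j , insert-dominates U S′ v dom′ , |S|≤a+1+j ,
      ≤-trans (geometric-step {j} a[N/K]ʲ≤m′ N*[a⊔m′]≤K*m) (*-monoˡ-≤ (K ^ suc j) (m≤n⊔m a m))
      where
      open ≤-Reasoning
      m = card U
      m′ = card (U ∖ closedNbhd (arc D) v)
      N*[a⊔m′]≤K*m : N * (a ⊔ m′) ≤ K * m
      N*[a⊔m′]≤K*m = ≤-trans (≤-reflexive (*-distribˡ-⊔ N a m′)) (⊔-lub (N*a≤K*m a<m)
        (N*m′≤K*m (card-∖closedNbhd (arc-irrefl D) U Uv) (card≤a[2Δ⁺+1] U (≤-trans (s≤s z≤n) a<m) v-max)))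
      |S|≤a+1+j : card (insert v S′) ≤ a + suc j
      |S|≤a+1+j = begin
        card (insert v S′) ≤⟨ card-insert-≤ v S′ ⟩
        suc (card S′)      ≤⟨ s≤s |S′|≤a+j ⟩
        suc (a + j)        ≡⟨ +-suc a j ⟨
        a + suc j          ∎

    greedy : ∀ f U → card U ≤ f → SmallDominator U
    greedy f U m≤f with card U ≤? a
    ... | yes m≤a = small-dominator U m≤a
    greedy zero U m≤0 | no m≰a = contradiction (≤-trans m≤0 z≤n) m≰a
    greedy (suc f) U m≤1+f | no m≰a with argmax U (deg (arc D) U)
    ... | inj₁ empty = contradiction (subst (_≤ a) (sym (card-∅ U empty)) z≤n) m≰a
    ... | inj₂ (v , Uv , v-max) =
      dominator-step U Uv v-max (≰⇒> m≰a) (greedy f (U ∖ closedNbhd (arc D) v) m′≤f)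
      where
      m′≤f : card (U ∖ closedNbhd (arc D) v) ≤ f
      m′≤f = ≤-pred (begin
        suc (card (U ∖ closedNbhd (arc D) v))         ≤⟨ s≤s (m≤m+n _ (deg (arc D) U v)) ⟩
        suc (card (U ∖ closedNbhd (arc D) v) + deg (arc D) U v) ≡⟨ +-suc _ _ ⟨
        card (U ∖ closedNbhd (arc D) v) + suc (deg (arc D) U v) ≡⟨ card-∖closedNbhd (arc-irrefl D) U Uv ⟨
        card U                                        ≤⟨ m≤1+f ⟩
        suc f                                         ∎)
        where open ≤-Reasoning

  -- multichoose L i = (L + i - 1 choose i), the number of i-element multisets over L elements.
  multichoose : ℕ → ℕ → ℕ
  multichoose L       zero    = 1
  multichoose zero    (suc i) = 0
  multichoose (suc L) (suc i) = multichoose L (suc i) + multichoose (suc L) i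

  multichoose-1 : ∀ L → multichoose L 1 ≡ L
  multichoose-1 zero    = refl
  multichoose-1 (suc L) = trans (cong (_+ 1) (multichoose-1 L)) (+-comm L 1)

  multichoose-suc : ∀ L i → multichoose L (suc i) * suc i ≡ multichoose L i * (L + i)
  multichoose-suc zero    zero    = refl
  multichoose-suc zero    (suc i) = refl
  multichoose-suc (suc L) zero    rewrite multichoose-1 L = L+1≡1+L L
    where
    L+1≡1+L : ∀ L → (L + 1) * 1 ≡ 1 * (suc L + 0)
    L+1≡1+L = solve-∀
  multichoose-suc (suc L) (suc i) = begin
    (x + y) * suc (suc i)                               ≡⟨ expand x y i ⟩
    x * suc (suc i) + y * suc i + y                     ≡⟨ cong₂ (λ p q → p + q + y) (multichoose-suc L (suc i))
                                                                                    (multichoose-suc (suc L) i) ⟩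
    x′ * (L + suc i) + y′ * (suc L + i) + (x′ + y′)     ≡⟨ collect x′ y′ L i ⟩
    (x′ + y′) * (suc L + suc i)                         ∎
    where
    open ≡-Reasoning
    x = multichoose L (suc (suc i))
    y = multichoose (suc L) (suc i)
    x′ = multichoose L (suc i)
    y′ = multichoose (suc L) i
    expand : ∀ x y i → (x + y) * suc (suc i) ≡ x * suc (suc i) + y * suc i + y
    expand = solve-∀
    collect : ∀ x y L i → x * (L + suc i) + y * (suc L + i) + (x + y) ≡ (x + y) * (suc L + suc i)
    collect = solve-∀

  module NegativeBinomial (K : ℕ) where

    N : ℕ
    N = suc K

    -- N ^ M · ∑_{i ≤ M} multichoose L i / N ^ i, a partial sum of the series of (1 - 1/N) ^ (- L).
    partialSum : ℕ → ℕ → ℕ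
    partialSum L zero    = 1
    partialSum L (suc M) = N * partialSum L M + multichoose L (suc M)

    partialSum-suc : ∀ L M → K * partialSum (suc L) M + multichoose (suc L) M ≡ N * partialSum L M
    partialSum-suc L zero    = K*1+1≡N*1 K
      where
      K*1+1≡N*1 : ∀ K → K * 1 + 1 ≡ suc K * 1
      K*1+1≡N*1 = solve-∀
    partialSum-suc L (suc M) = begin
      K * (N * P + (x + y)) + (x + y)     ≡⟨ regroup K P x y ⟩
      N * (K * P + y) + N * x             ≡⟨ cong (λ k → N * k + N * x) (partialSum-suc L M) ⟩
      N * (N * partialSum L M) + N * x    ≡⟨ *-distribˡ-+ N (N * partialSum L M) x ⟨
      N * (N * partialSum L M + x)        ∎
      where
      open ≡-Reasoning
      P = partialSum (suc L) M
      x = multichoose L (suc M)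
      y = multichoose (suc L) M
      regroup : ∀ K p x y → K * (suc K * p + (x + y)) + (x + y) ≡ suc K * (K * p + y) + suc K * x
      regroup = solve-∀

    partialSum-zero : ∀ M → partialSum 0 M ≡ N ^ M
    partialSum-zero zero    = refl
    partialSum-zero (suc M) = trans (+-identityʳ _) (cong (N *_) (partialSum-zero M))

    partialSum-bound : ∀ L M → K ^ L * partialSum L M ≤ N ^ L * N ^ M
    partialSum-bound zero    M = ≤-reflexive (trans (*-identityˡ _) (trans (partialSum-zero M) (sym (*-identityˡ _))))
    partialSum-bound (suc L) M = begin
      K * K ^ L * partialSum (suc L) M                            ≡⟨ xy∙z≈y∙xz K (K ^ L) _ ⟩
      K ^ L * (K * partialSum (suc L) M)                          ≤⟨ *-monoʳ-≤ (K ^ L) (m≤m+n _ (multichoose (suc L) M)) ⟩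
      K ^ L * (K * partialSum (suc L) M + multichoose (suc L) M)  ≡⟨ cong (K ^ L *_) (partialSum-suc L M) ⟩
      K ^ L * (N * partialSum L M)                                ≡⟨ x∙yz≈y∙xz (K ^ L) N _ ⟩
      N * (K ^ L * partialSum L M)                                ≤⟨ *-monoʳ-≤ N (partialSum-bound L M) ⟩
      N * (N ^ L * N ^ M)                                         ≡⟨ *-assoc N (N ^ L) (N ^ M) ⟨
      N * N ^ L * N ^ M                                           ∎
      where open ≤-Reasoning

  degreeSum : Graph n → ℕ
  degreeSum {n} G = List.sum (List.map (degree G) (List.allFin n))

  card-tabulate : (P : VSet n) → ∣ tabulate P ∣ ≡ card P
  card-tabulate {zero}  P = refl
  card-tabulate {suc n} P with P zero
  ... | true  = cong suc (card-tabulate (P ∘ suc))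
  ... | false = card-tabulate (P ∘ suc)

  ∈-tabulate⁻ : {P : VSet n} {u : Fin n} → u ∈ tabulate P → P u ≡ true
  ∈-tabulate⁻ {P = P} {u} u∈P = trans (sym (lookup∘tabulate P u)) ([]=⇒lookup u∈P)

  ∈-tabulate⁺ : {P : VSet n} {u : Fin n} → P u ≡ true → u ∈ tabulate P
  ∈-tabulate⁺ {P = P} {u} Pu = lookup⇒[]= u (tabulate P) (trans (lookup∘tabulate P u) Pu)

  module _ {G : Graph n} {a : ℕ} (α≡a : IsIndependenceNumber G a) where

    independent≤α : ∀ I → Independent G I → card I ≤ a
    independent≤α I indep = subst (_≤ a) (card-tabulate I)
      (proj₂ α≡a (tabulate I) λ u w u∈I w∈I → indep u w (∈-tabulate⁻ u∈I) (∈-tabulate⁻ w∈I))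

    turán-α : ∀ U → card U * card U ≤ a * (degSum (adj G) U + card U)
    turán-α U = turán G a U (λ I _ → independent≤α I)

    α≤n : a ≤ n
    α≤n with S , _ , ∣S∣≡a ← proj₁ α≡a = subst (_≤ n) ∣S∣≡a (∣p∣≤n S)

    1≤α : Fin n → 1 ≤ a
    1≤α v = subst (_≤ a) (card-⁅⁆ v) (independent≤α ⁅ v ⁆ (⁅⁆-independent G v))

    n≤α*χ : ∀ {c} → IsChromaticNumber G c → n ≤ a * c
    n≤α*χ {c} ((colour , proper) , _) = begin
      n                                   ≡⟨ card-full n ⟨
      ∑[ u < n ] 1                        ≡⟨ sum-cong-≗ (λ u → card-⁅⁆ (colour u)) ⟨
      ∑[ u < n ] ∑[ i < c ] 𝟙 (class i u) ≡⟨ ∑-comm (λ u i → 𝟙 (class i u)) ⟩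
      ∑[ i < c ] card (class i)           ≤⟨ ∑-mono-≤ (λ i → independent≤α (class i) (class-independent i)) ⟩
      ∑[ i < c ] a                        ≡⟨ ∑-const c a ⟩
      c * a                               ≡⟨ *-comm c a ⟩
      a * c                               ∎
      where
      open ≤-Reasoning
      class : Fin c → VSet n
      class i u = ⁅ colour u ⁆ i
      class-independent : ∀ i → Independent G (class i)
      class-independent i u w iu iw with adj G u w in uw
      ... | false = refl
      ... | true  = contradiction (trans (⁅⁆⇒≡ iu) (sym (⁅⁆⇒≡ iw))) (proper u w uw)

    n²≤α[degreeSum+n] : n * n ≤ a * (degreeSum G + n)
    n²≤α[degreeSum+n] = subst₂ (λ m s → m * m ≤ a * (s + m)) (card-full n) (sym degreeSum≡degSum) (turán-α (full n))
      where
      sum-tabulate : ∀ {n} (f : Fin n → ℕ) → List.sum (List.tabulate f) ≡ ∑ f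
      sum-tabulate {zero}  f = refl
      sum-tabulate {suc n} f = cong (f zero +_) (sum-tabulate (f ∘ suc))
      degreeSum≡degSum : degreeSum G ≡ degSum (adj G) (full n)
      degreeSum≡degSum = begin
        List.sum (List.map (degree G) (List.allFin n))    ≡⟨ cong List.sum (map-tabulate id (degree G)) ⟩
        List.sum (List.tabulate (degree G))               ≡⟨ sum-tabulate (degree G) ⟩
        ∑[ u < n ] degree G u                             ≡⟨ sum-cong-≗ (λ u → card-tabulate (adj G u)) ⟩
        ∑[ u < n ] card (adj G u)                         ≡⟨ sum-cong-≗ (λ u → trans (sum-cong-≗ (λ w → sym (*-identityˡ (𝟙 (adj G u w)))))
                                                                                      (sym (*-identityˡ _))) ⟩
        degSum (adj G) (full n)                           ∎
        where open ≡-Reasoning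

  module _ {G : Graph n} (D : Orientation G) {a′ : ℕ} (α≡a : IsIndependenceNumber G (suc a′)) where
    open Ratio a′
    open GreedyDomination D a′ (turán-α {G = G} α≡a)

    γ-bound : ∀ {Γ} → IsDirDomNumber D Γ → ∃[ j ] Γ ≤ a + j × a * N ^ j ≤ n * K ^ j
    γ-bound {Γ} (_ , Γ-min) with S , j , dom , |S|≤a+j , a[N/K]ʲ≤a⊔n ← greedy n (full n) (≤-reflexive (card-full n)) =
      j , Γ≤a+j , subst (λ m → a * N ^ j ≤ m * K ^ j) a⊔n≡n a[N/K]ʲ≤a⊔n
      where
      dominating : IsDirDominating D (tabulate S)
      dominating u u∉S with dom u refl
      ... | inj₁ Su              = contradiction (∈-tabulate⁺ Su) u∉S
      ... | inj₂ (v , Sv , vu⃗) = v , ∈-tabulate⁺ Sv , vu⃗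
      Γ≤a+j : Γ ≤ a + j
      Γ≤a+j = ≤-trans (Γ-min (tabulate S) dominating) (≤-trans (≤-reflexive (card-tabulate S)) |S|≤a+j)
      a⊔n≡n : a ⊔ card (full n) ≡ n
      a⊔n≡n = trans (cong (a ⊔_) (card-full n)) (m≤n⇒m⊔n≡n (α≤n {G = G} α≡a))

module RationalBounds where

  open import Defs using (Graph; IsIndependenceNumber; IsChromaticNumber; avgDegree; expTerm; expPartial; _^ℚ_; ExpLE; LeLnBound)
  open Combinatorics using (module Ratio; module NegativeBinomial; multichoose; multichoose-suc; degreeSum; n²≤α[degreeSum+n]; n≤α*χ)
  open import Data.Nat as ℕ using (ℕ; zero; suc; NonZero; >-nonZero; z≤n; s≤s)
  import Data.Nat.Properties as ℕ
  open import Algebra.Properties.CommutativeSemigroup ℕ.*-commutativeSemigroup using (interchange)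
  open import Data.Integer as ℤ using (+_)
  import Data.Integer.Properties as ℤ
  import Data.Nat.Coprimality as Coprime
  open import Data.Rational using (ℚ; mkℚ; _/_; 0ℚ; 1ℚ; _+_; _*_; _≤_; *≤*; toℚᵘ; Positive; NonNegative; nonNegative)
  open import Data.Rational.Properties
  import Data.Rational.Unnormalised as ℚᵘ
  import Data.Rational.Unnormalised.Properties as ℚᵘ
  open import Data.Rational.Solver using (module +-*-Solver)
  open import Relation.Binary.PropositionalEquality

  ι : ℕ → ℚ
  ι m = + m / 1

  ι≡mkℚ : ∀ m → ι m ≡ mkℚ (+ m) 0 (Coprime.sym (Coprime.1-coprimeTo m))
  ι≡mkℚ m = normalize-coprime (Coprime.sym (Coprime.1-coprimeTo m))

  ι-* : ∀ m n → ι (m ℕ.* n) ≡ ι m * ι n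
  ι-* m n = trans (cong (_/ 1) (ℤ.pos-* m n)) (sym (cong₂ _*_ (ι≡mkℚ m) (ι≡mkℚ n)))

  ι-+ : ∀ m n → ι (m ℕ.+ n) ≡ ι m + ι n
  ι-+ m n = trans (cong (_/ 1) (trans (ℤ.pos-+ m n) (sym (cong₂ ℤ._+_ (ℤ.*-identityʳ (+ m)) (ℤ.*-identityʳ (+ n))))))
                  (sym (cong₂ _+_ (ι≡mkℚ m) (ι≡mkℚ n)))

  ι-^ : ∀ m k → ι (m ℕ.^ k) ≡ ι m ^ℚ k
  ι-^ m zero    = refl
  ι-^ m (suc k) = trans (ι-* m (m ℕ.^ k)) (cong (ι m *_) (ι-^ m k))

  ι-mono-≤ : ∀ {m n} → m ℕ.≤ n → ι m ≤ ι n
  ι-mono-≤ {m} {n} m≤n rewrite ι≡mkℚ m | ι≡mkℚ n =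
    *≤* (subst₂ ℤ._≤_ (sym (ℤ.*-identityʳ (+ m))) (sym (ℤ.*-identityʳ (+ n))) (ℤ.+≤+ m≤n))

  ι-nonNeg : ∀ m → NonNegative (ι m)
  ι-nonNeg m = normalize-nonNeg m 1

  ι-pos : ∀ m .{{_ : NonZero m}} → Positive (ι m)
  ι-pos m = normalize-pos m 1

  0≤ι : ∀ m → 0ℚ ≤ ι m
  0≤ι m = nonNegative⁻¹ (ι m) {{ι-nonNeg m}}

  /-*-cancel : ∀ m d .{{_ : NonZero d}} → (+ m / d) * ι d ≡ ι m
  /-*-cancel m (suc d-1) = toℚᵘ-injective (begin
    toℚᵘ ((+ m / d) * ι d)                  ≈⟨ toℚᵘ-homo-* (+ m / d) (ι d) ⟩
    toℚᵘ (+ m / d) ℚᵘ.* toℚᵘ (ι d)          ≈⟨ ℚᵘ.*-cong (toℚᵘ-fromℚᵘ (ℚᵘ.mkℚᵘ (+ m) d-1))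
                                                          (toℚᵘ-fromℚᵘ (ℚᵘ.mkℚᵘ (+ d) 0)) ⟩
    ℚᵘ.mkℚᵘ (+ m) d-1 ℚᵘ.* ℚᵘ.mkℚᵘ (+ d) 0  ≈⟨ ℚᵘ.*≡* m*d*1≡m*d ⟩
    ℚᵘ.mkℚᵘ (+ m) 0                         ≈⟨ ℚᵘ.≃-sym (toℚᵘ-fromℚᵘ (ℚᵘ.mkℚᵘ (+ m) 0)) ⟩
    toℚᵘ (ι m)                              ∎)
    where
    open ℚᵘ.≃-Reasoning
    d = suc d-1
    m*d*1≡m*d : (+ m ℤ.* + d) ℤ.* + 1 ≡ + m ℤ.* + suc (d-1 ℕ.* 1)
    m*d*1≡m*d rewrite ℕ.*-identityʳ d-1 = ℤ.*-identityʳ _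

  ^-distribʳ-* : ∀ m n k → (m ℕ.* n) ℕ.^ k ≡ m ℕ.^ k ℕ.* n ℕ.^ k
  ^-distribʳ-* m n zero    = refl
  ^-distribʳ-* m n (suc k) = trans (cong (m ℕ.* n ℕ.*_) (^-distribʳ-* m n k)) (interchange m n (m ℕ.^ k) (n ℕ.^ k))

  ^ℚ-distribʳ-* : ∀ p q k → (p * q) ^ℚ k ≡ p ^ℚ k * q ^ℚ k
  ^ℚ-distribʳ-* p q zero    = refl
  ^ℚ-distribʳ-* p q (suc k) = trans (cong (p * q *_) (^ℚ-distribʳ-* p q k)) (interchangeℚ p q (p ^ℚ k) (q ^ℚ k))
    where
    open +-*-Solver
    interchangeℚ : ∀ p q x y → p * q * (x * y) ≡ p * x * (q * y)
    interchangeℚ = solve 4 (λ p q x y → p :* q :* (x :* y) := p :* x :* (q :* y)) refl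

  ^ℚ-nonNeg : ∀ {p} k → 0ℚ ≤ p → 0ℚ ≤ p ^ℚ k
  ^ℚ-nonNeg         zero    0≤p = nonNegative⁻¹ 1ℚ
  ^ℚ-nonNeg {p} (suc k) 0≤p = nonNegative⁻¹ (p * p ^ℚ k)
    {{nonNeg*nonNeg⇒nonNeg p {{nonNegative 0≤p}} (p ^ℚ k) {{nonNegative (^ℚ-nonNeg k 0≤p)}}}}

  ^ℚ-monoˡ-≤ : ∀ {p q} k → 0ℚ ≤ p → p ≤ q → p ^ℚ k ≤ q ^ℚ k
  ^ℚ-monoˡ-≤         zero    _   _   = ≤-refl
  ^ℚ-monoˡ-≤ {p} {q} (suc k) 0≤p p≤q = begin
    p * p ^ℚ k ≤⟨ *-monoʳ-≤-nonNeg (p ^ℚ k) {{nonNegative (^ℚ-nonNeg k 0≤p)}} p≤q ⟩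
    q * p ^ℚ k ≤⟨ *-monoˡ-≤-nonNeg q {{nonNegative (≤-trans 0≤p p≤q)}} (^ℚ-monoˡ-≤ k 0≤p p≤q) ⟩
    q * q ^ℚ k ∎
    where open ≤-Reasoning

  module ExponentialBound (K : ℕ) where
    open NegativeBinomial K

    -- (Nk)(Nk + 1)⋯(Nk + i - 1) / i! ≥ (Nk) ^ i / i!, and dividing by N ^ i leaves k ^ i / i!.
    expTerm-≤ : ∀ k i → expTerm k i * ι (N ℕ.^ i) ≤ ι (multichoose (N ℕ.* k) i)
    expTerm-≤ k zero    = ≤-refl
    expTerm-≤ k (suc i) = *-cancelʳ-≤-pos (ι (suc i)) {{ι-pos (suc i)}} (begin
      T * q * ι (N ℕ.* N ℕ.^ i) * ι (suc i)   ≡⟨ cong (λ x → T * q * x * ι (suc i)) (ι-* N (N ℕ.^ i)) ⟩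
      T * q * (ι N * P) * ι (suc i)           ≡⟨ regroup T q (ι N) P (ι (suc i)) ⟩
      T * P * (ι N * (q * ι (suc i)))         ≡⟨ cong (λ x → T * P * (ι N * x)) (/-*-cancel k (suc i)) ⟩
      T * P * (ι N * ι k)                     ≡⟨ cong (T * P *_) (ι-* N k) ⟨
      T * P * ι L                             ≤⟨ *-monoʳ-≤-nonNeg (ι L) {{ι-nonNeg L}} (expTerm-≤ k i) ⟩
      ι (multichoose L i) * ι L               ≡⟨ ι-* (multichoose L i) L ⟨
      ι (multichoose L i ℕ.* L)               ≤⟨ ι-mono-≤ (ℕ.*-monoʳ-≤ (multichoose L i) (ℕ.m≤m+n L i)) ⟩
      ι (multichoose L i ℕ.* (L ℕ.+ i))       ≡⟨ cong ι (multichoose-suc L i) ⟨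
      ι (multichoose L (suc i) ℕ.* suc i)     ≡⟨ ι-* (multichoose L (suc i)) (suc i) ⟩
      ι (multichoose L (suc i)) * ι (suc i)   ∎)
      where
      open ≤-Reasoning
      open +-*-Solver
      T = expTerm k i
      q = + k / suc i
      P = ι (N ℕ.^ i)
      L = N ℕ.* k
      regroup : ∀ T q n P s → T * q * (n * P) * s ≡ T * P * (n * (q * s))
      regroup = solve 5 (λ T q n P s → T :* q :* (n :* P) :* s := T :* P :* (n :* (q :* s))) refl

    expPartial-≤ : ∀ k M → expPartial k M * ι (N ℕ.^ M) ≤ ι (partialSum (N ℕ.* k) M)
    expPartial-≤ k zero    = ≤-refl
    expPartial-≤ k (suc M) = begin
      (E + T) * ι (N ℕ.* N ℕ.^ M)                           ≡⟨ cong ((E + T) *_) (ι-* N (N ℕ.^ M)) ⟩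
      (E + T) * (ι N * P)                                   ≡⟨ distribute E T (ι N) P ⟩
      ι N * (E * P) + T * (ι N * P)                         ≡⟨ cong (λ x → ι N * (E * P) + T * x) (ι-* N (N ℕ.^ M)) ⟨
      ι N * (E * P) + T * ι (N ℕ.* N ℕ.^ M)                 ≤⟨ +-mono-≤ (*-monoˡ-≤-nonNeg (ι N) {{ι-nonNeg N}} (expPartial-≤ k M))
                                                                        (expTerm-≤ k (suc M)) ⟩
      ι N * ι (partialSum L M) + ι (multichoose L (suc M))  ≡⟨ cong (_+ ι (multichoose L (suc M))) (ι-* N (partialSum L M)) ⟨
      ι (N ℕ.* partialSum L M) + ι (multichoose L (suc M))  ≡⟨ ι-+ (N ℕ.* partialSum L M) (multichoose L (suc M)) ⟨
      ι (partialSum L (suc M))                              ∎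
      where
      open ≤-Reasoning
      open +-*-Solver
      E = expPartial k M
      T = expTerm k (suc M)
      P = ι (N ℕ.^ M)
      L = N ℕ.* k
      distribute : ∀ e t n p → (e + t) * (n * p) ≡ n * (e * p) + t * (n * p)
      distribute = solve 4 (λ e t n p → (e :+ t) :* (n :* p) := n :* (e :* p) :+ t :* (n :* p)) refl

    expPartial-≤-pow : ∀ k M → expPartial k M * ι (K ℕ.^ (N ℕ.* k)) ≤ ι (N ℕ.^ (N ℕ.* k))
    expPartial-≤-pow k M = *-cancelʳ-≤-pos (ι (N ℕ.^ M)) {{ι-pos (N ℕ.^ M) {{ℕ.m^n≢0 N M}}}} (begin
      E * ι (K ℕ.^ L) * ι (N ℕ.^ M)     ≡⟨ swap E (ι (K ℕ.^ L)) (ι (N ℕ.^ M)) ⟩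
      ι (K ℕ.^ L) * (E * ι (N ℕ.^ M))   ≤⟨ *-monoˡ-≤-nonNeg (ι (K ℕ.^ L)) {{ι-nonNeg (K ℕ.^ L)}} (expPartial-≤ k M) ⟩
      ι (K ℕ.^ L) * ι (partialSum L M)  ≡⟨ ι-* (K ℕ.^ L) (partialSum L M) ⟨
      ι (K ℕ.^ L ℕ.* partialSum L M)    ≤⟨ ι-mono-≤ (partialSum-bound L M) ⟩
      ι (N ℕ.^ L ℕ.* N ℕ.^ M)           ≡⟨ ι-* (N ℕ.^ L) (N ℕ.^ M) ⟩
      ι (N ℕ.^ L) * ι (N ℕ.^ M)         ∎)
      where
      open ≤-Reasoning
      open +-*-Solver
      E = expPartial k M
      L = N ℕ.* k
      swap : ∀ e x y → e * x * y ≡ x * (e * y)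
      swap = solve 3 (λ e x y → e :* x :* y := x :* (e :* y)) refl

  module _ (a′ : ℕ) where
    open Ratio a′
    open ExponentialBound K

    instance
      K-nonZero : NonZero K
      K-nonZero = >-nonZero (ℕ.≤-trans (s≤s z≤n) (ℕ.m≤n+m (suc a′ ℕ.+ 0) a′))

    geometric-pow : ∀ {k n} → a ℕ.* N ℕ.^ k ℕ.≤ n ℕ.* K ℕ.^ k →
                    a ℕ.^ N ℕ.* N ℕ.^ (N ℕ.* k) ℕ.≤ n ℕ.^ N ℕ.* K ℕ.^ (N ℕ.* k)
    geometric-pow {k} {n} a[N/K]ᵏ≤n = begin
      a ℕ.^ N ℕ.* N ℕ.^ (N ℕ.* k)    ≡⟨ cong (a ℕ.^ N ℕ.*_) (pow-swap N) ⟩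
      a ℕ.^ N ℕ.* (N ℕ.^ k) ℕ.^ N    ≡⟨ ^-distribʳ-* a (N ℕ.^ k) N ⟨
      (a ℕ.* N ℕ.^ k) ℕ.^ N          ≤⟨ ℕ.^-monoˡ-≤ N a[N/K]ᵏ≤n ⟩
      (n ℕ.* K ℕ.^ k) ℕ.^ N          ≡⟨ ^-distribʳ-* n (K ℕ.^ k) N ⟩
      n ℕ.^ N ℕ.* (K ℕ.^ k) ℕ.^ N    ≡⟨ cong (n ℕ.^ N ℕ.*_) (pow-swap K) ⟨
      n ℕ.^ N ℕ.* K ℕ.^ (N ℕ.* k)    ∎
      where
      open ℕ.≤-Reasoning
      pow-swap : ∀ x → x ℕ.^ (N ℕ.* k) ≡ (x ℕ.^ k) ℕ.^ N
      pow-swap x = trans (cong (x ℕ.^_) (ℕ.*-comm N k)) (sym (ℕ.^-*-assoc x k N))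

    expPartial-≤-x^N : ∀ {k n} (x : ℚ) → 0ℚ ≤ x → ι n ≤ ι a * x →
                       a ℕ.* N ℕ.^ k ℕ.≤ n ℕ.* K ℕ.^ k → ExpLE k (x ^ℚ N)
    expPartial-≤-x^N {k} {n} x 0≤x n≤ax a[N/K]ᵏ≤n M =
      *-cancelʳ-≤-pos (ι (a ℕ.^ N)) {{ι-pos (a ℕ.^ N) {{ℕ.m^n≢0 a N}}}} (begin
        E * ι (a ℕ.^ N)         ≤⟨ E*aᴺ≤nᴺ ⟩
        ι (n ℕ.^ N)             ≡⟨ ι-^ n N ⟩
        ι n ^ℚ N                ≤⟨ ^ℚ-monoˡ-≤ N (0≤ι n) n≤ax ⟩
        (ι a * x) ^ℚ N          ≡⟨ ^ℚ-distribʳ-* (ι a) x N ⟩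
        ι a ^ℚ N * x ^ℚ N       ≡⟨ cong (_* x ^ℚ N) (ι-^ a N) ⟨
        ι (a ℕ.^ N) * x ^ℚ N    ≡⟨ *-comm (ι (a ℕ.^ N)) (x ^ℚ N) ⟩
        x ^ℚ N * ι (a ℕ.^ N)    ∎)
      where
      open ≤-Reasoning
      open +-*-Solver
      E = expPartial k M
      L = N ℕ.* k
      swap : ∀ e x y → e * x * y ≡ x * (e * y)
      swap = solve 3 (λ e x y → e :* x :* y := x :* (e :* y)) refl
      E*aᴺ≤nᴺ : E * ι (a ℕ.^ N) ≤ ι (n ℕ.^ N)
      E*aᴺ≤nᴺ = *-cancelʳ-≤-pos (ι (K ℕ.^ L)) {{ι-pos (K ℕ.^ L) {{ℕ.m^n≢0 K L}}}} (begin
        E * ι (a ℕ.^ N) * ι (K ℕ.^ L)    ≡⟨ swap E (ι (a ℕ.^ N)) (ι (K ℕ.^ L)) ⟩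
        ι (a ℕ.^ N) * (E * ι (K ℕ.^ L))  ≤⟨ *-monoˡ-≤-nonNeg (ι (a ℕ.^ N)) {{ι-nonNeg (a ℕ.^ N)}} (expPartial-≤-pow k M) ⟩
        ι (a ℕ.^ N) * ι (N ℕ.^ L)        ≡⟨ ι-* (a ℕ.^ N) (N ℕ.^ L) ⟨
        ι (a ℕ.^ N ℕ.* N ℕ.^ L)          ≤⟨ ι-mono-≤ (geometric-pow {k} {n} a[N/K]ᵏ≤n) ⟩
        ι (n ℕ.^ N ℕ.* K ℕ.^ L)          ≡⟨ ι-* (n ℕ.^ N) (K ℕ.^ L) ⟩
        ι (n ℕ.^ N) * ι (K ℕ.^ L)        ∎)

    leLnBound : ∀ {Γ n} j (x : ℚ) → 0ℚ ≤ x → ι n ≤ ι a * x →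
                Γ ℕ.≤ a ℕ.+ j → a ℕ.* N ℕ.^ j ℕ.≤ n ℕ.* K ℕ.^ j → LeLnBound Γ a x
    leLnBound {n = n} j x 0≤x n≤ax Γ≤a+j a[N/K]ʲ≤n k a+k≡Γ =
      expPartial-≤-x^N {k} {n} x 0≤x n≤ax (geometric-≤′ n (ℕ.≤⇒≤′ k≤j) a[N/K]ʲ≤n)
      where
      k≤j : k ℕ.≤ j
      k≤j = ℕ.+-cancelˡ-≤ a k j (ℕ.≤-trans (ℕ.≤-reflexive a+k≡Γ) Γ≤a+j)

  n≤α*[d̄+1] : ∀ {n} .{{_ : NonZero n}} {G : Graph n} {a} → IsIndependenceNumber G a →
              ι n ≤ ι a * (avgDegree G + 1ℚ)
  n≤α*[d̄+1] {n} {G} {a} α≡a = *-cancelʳ-≤-pos (ι n) {{ι-pos n}} (begin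
    ι n * ι n                         ≡⟨ ι-* n n ⟨
    ι (n ℕ.* n)                       ≤⟨ ι-mono-≤ (n²≤α[degreeSum+n] {G = G} α≡a) ⟩
    ι (a ℕ.* (s ℕ.+ n))               ≡⟨ trans (ι-* a (s ℕ.+ n)) (cong (ι a *_) (ι-+ s n)) ⟩
    ι a * (ι s + ι n)                 ≡⟨ cong (λ x → ι a * (x + ι n)) (/-*-cancel s n) ⟨
    ι a * (avgDegree G * ι n + ι n)   ≡⟨ factor (ι a) (avgDegree G) (ι n) ⟩
    ι a * (avgDegree G + 1ℚ) * ι n    ∎)
    where
    open ≤-Reasoning
    open +-*-Solver
    s = degreeSum G
    factor : ∀ A d m → A * (d * m + m) ≡ A * (d + 1ℚ) * m
    factor = solve 3 (λ A d m → A :* (d :* m :+ m) := A :* (d :+ con 1ℚ) :* m) refl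

  n≤α*χ-ℚ : ∀ {n} {G : Graph n} {a c} → IsIndependenceNumber G a → IsChromaticNumber G c → ι n ≤ ι a * ι c
  n≤α*χ-ℚ {G = G} {a} {c} α≡a χ≡c = ≤-trans (ι-mono-≤ (n≤α*χ {G = G} α≡a χ≡c)) (≤-reflexive (ι-* a c))

  0≤d̄+1 : ∀ {n} .{{_ : NonZero n}} (G : Graph n) → 0ℚ ≤ avgDegree G + 1ℚ
  0≤d̄+1 {n} G = nonNegative⁻¹ _ {{nonNeg+nonNeg⇒nonNeg (avgDegree G) {{normalize-nonNeg (degreeSum G) n}} 1ℚ}}


open import Defs
open import Data.Nat using (ℕ; NonZero)
open import Data.Integer using (+_)
open import Data.Rational using (_/_; 1ℚ; _+_)
open import Data.Product using (_×_)

open import Data.Nat using (zero; suc)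
open import Data.Rational using (0ℚ; _*_; _≤_)
import Data.Fin as Fin
open import Data.Product using (_,_)
open import Relation.Nullary using (contradiction)
open Combinatorics using (1≤α; γ-bound)
open RationalBounds using (ι; 0≤ι; leLnBound; n≤α*χ-ℚ; 0≤d̄+1; n≤α*[d̄+1])

corollary2p4 : (n : ℕ) .{{_ : NonZero n}} (G : Graph n) (Γ a c : ℕ) →
    IsOrientedDomNumber G Γ → IsIndependenceNumber G a → IsChromaticNumber G c →
    LeLnBound Γ a (+ c / 1) × LeLnBound Γ a (avgDegree G + 1ℚ)
corollary2p4 zero {{()}}
corollary2p4 (suc n′) G Γ zero c _ α≡0 _ = contradiction (1≤α {G = G} α≡0 Fin.zero) λ ()
corollary2p4 (suc n′) G Γ (suc a′) c ((D , γ≡Γ) , _) α≡a χ≡c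
  with j , Γ≤a+j , a[N/K]ʲ≤n ← γ-bound D {a′} α≡a γ≡Γ =
  bound (+ c / 1) (0≤ι c) (n≤α*χ-ℚ {G = G} α≡a χ≡c) , bound (avgDegree G + 1ℚ) (0≤d̄+1 G) (n≤α*[d̄+1] {G = G} α≡a)
  where
  bound : ∀ x → 0ℚ ≤ x → ι (suc n′) ≤ ι (suc a′) * x → LeLnBound Γ (suc a′) x
  bound x 0≤x n≤ax = leLnBound a′ {Γ} {suc n′} j x 0≤x n≤ax Γ≤a+j a[N/K]ʲ≤n
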